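{- Let $p_{(2,1,2)}(n)$ denote the number of positive integers $m\le n$ such that $B(m^2)=B(m)$. Then $p_{(2,1,2)}(n)\gg n^{0.025}$, i.e., there is a constant $c>0$ such that $p_{(2,1,2)}(n)\ge c\,n^{0.025}$ for all sufficiently large $n$.
   Context: For a positive integer $m$, $B(m)$ denotes the sum of the digits of $m$ written in base $2$ (the number of ones in its binary expansion). A positive integer $m$ with $B(m^2)=B(m)$ is called a $(2,1,2)$-number. -}

module Defs where

open import Data.Nat using (ℕ; zero; suc; _+_; _*_; _^_; _≡ᵇ_)
open import Data.Nat.DivMod using (_/_; _%_)
open import Data.Bool using (if_then_else_)

-- Sum of binary digits of m, computed with fuel; fuel ≥ m suffices
-- (each step halves m, and m ≥ 1 strictly decreases).
B-aux : ℕ → ℕ → ℕ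
B-aux zero    m = 0
B-aux (suc f) m = m % 2 + B-aux f (m / 2)

B : ℕ → ℕ
B m = B-aux m m

is212 : ℕ → ℕ
is212 zero    = 0
is212 (suc k) = if B ((suc k) * (suc k)) ≡ᵇ B (suc k) then 1 else 0

p212 : ℕ → ℕ
p212 zero    = 0
p212 (suc n) = is212 (suc n) + p212 n

module Submission where

-- Fix t ≥ 1 with B(t) + B(t²) = a + 1, and put A = 2^a > t and E = 2^L ≥ 2tA. The number
-- m = (A − 1)E − t satisfies m = (A − 2)E + (E − t) and m² = (A − 2)A·E² + (E − 2t(A − 1))E + t²,
-- both concatenations of binary blocks. Counting ones blockwise with the complement rule
-- B(x) + B(2^k − 1 − x) = k turns B(m²) = B(m) into exactly B(t) + B(t²) = a + 1.
-- For t = 2^ℓ − (d + 1) with ℓ = 2h + 2 and d < 2^h, the ones of t and t² alone force a ≥ ℓ,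
-- hence A > t; the residue E − t of m mod E recovers d, so this gives 2^h distinct
-- (2,1,2)-numbers below 2^(14h+15), i.e. p(n) ≫ n^(1/14).

open import Defs
open import Data.Nat
open import Data.Nat.Properties
open import Data.Nat.DivMod using (m/n<m; m*n/n≡m; m*n%n≡0; [m+kn]%n≡m%n; +-distrib-/-∣ʳ; m<n⇒m%n≡m)
open import Data.Nat.Divisibility using (divides-refl)
open import Data.Nat.Tactic.RingSolver using (solve-∀)
open import Data.Product using (Σ; _,_; _×_; ∃-syntax)
open import Data.Sum using (inj₁; inj₂)
open import Data.Bool using (true)
open import Data.Empty using (⊥-elim)
open import Data.Fin using (Fin; toℕ; fromℕ<)
open import Data.Fin.Properties using (toℕ<n; toℕ-fromℕ<; toℕ-injective; injective⇒≤)
open import Function using (_∘_)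
open import Function.Definitions using (Injective)
open import Relation.Nullary using (contradiction)
open import Relation.Binary using (tri<; tri≈; tri>)
open import Relation.Binary.PropositionalEquality

B-aux-zero : ∀ f → B-aux f 0 ≡ 0
B-aux-zero zero    = refl
B-aux-zero (suc f) = B-aux-zero f

half-≤ : ∀ m f → m ≤ suc f → m / 2 ≤ f
half-≤ zero    f _   = z≤n
half-≤ (suc m) f m≤ = ≤-pred (≤-trans (m/n<m (suc m) 2 (s≤s (s≤s z≤n))) m≤)

B-aux-fuel : ∀ f g m → m ≤ f → m ≤ g → B-aux f m ≡ B-aux g m
B-aux-fuel zero    zero    m       _   _   = refl
B-aux-fuel zero    (suc g) zero    _   _   = sym (B-aux-zero g)
B-aux-fuel (suc f) zero    zero    _   _   = B-aux-zero f
B-aux-fuel (suc f) (suc g) m       m≤f m≤g =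
  cong (m % 2 +_) (B-aux-fuel f g (m / 2) (half-≤ m f m≤f) (half-≤ m g m≤g))

B-step : ∀ m → B m ≡ m % 2 + B (m / 2)
B-step zero    = refl
B-step (suc m) = cong (suc m % 2 +_)
  (B-aux-fuel m (suc m / 2) (suc m / 2) (half-≤ (suc m) m ≤-refl) ≤-refl)

B-double : ∀ q → B (2 * q) ≡ B q
B-double q = begin
  B (2 * q)                    ≡⟨ cong B (*-comm 2 q) ⟩
  B (q * 2)                    ≡⟨ B-step (q * 2) ⟩
  q * 2 % 2 + B (q * 2 / 2)    ≡⟨ cong₂ (λ r h → r + B h) (m*n%n≡0 q 2) (m*n/n≡m q 2) ⟩
  B q                          ∎
  where open ≡-Reasoning

B-double+1 : ∀ q → B (suc (2 * q)) ≡ suc (B q)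
B-double+1 q = begin
  B (suc (2 * q))                        ≡⟨ cong (B ∘ suc) (*-comm 2 q) ⟩
  B (1 + q * 2)                          ≡⟨ B-step (1 + q * 2) ⟩
  (1 + q * 2) % 2 + B ((1 + q * 2) / 2)  ≡⟨ cong₂ (λ r h → r + B h) ([m+kn]%n≡m%n 1 q 2) half ⟩
  suc (B q)                              ∎
  where
  open ≡-Reasoning
  half : (1 + q * 2) / 2 ≡ q
  half = trans (+-distrib-/-∣ʳ 1 {d = 2} (divides-refl q)) (m*n/n≡m q 2)

data Halves : ℕ → Set where
  even : ∀ q → Halves (2 * q)
  odd  : ∀ q → Halves (suc (2 * q))

halves : ∀ n → Halves n
halves zero = even 0
halves (suc n) with halves n
... | even q = odd q
... | odd q  = subst Halves (cong suc (+-suc q (q + 0))) (even (suc q))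

B-concat : ∀ s x y → y < 2 ^ s → B (x * 2 ^ s + y) ≡ B x + B y
B-concat zero    x .0 (s≤s z≤n) =
  trans (cong B (trans (+-identityʳ (x * 1)) (*-identityʳ x))) (sym (+-identityʳ (B x)))
B-concat (suc s) x y y< with halves y
... | even q = begin
  B (x * 2 ^ suc s + 2 * q)  ≡⟨ cong B shift ⟩
  B (2 * (x * 2 ^ s + q))    ≡⟨ B-double (x * 2 ^ s + q) ⟩
  B (x * 2 ^ s + q)          ≡⟨ B-concat s x q (*-cancelˡ-< 2 q (2 ^ s) y<) ⟩
  B x + B q                  ≡⟨ cong (B x +_) (B-double q) ⟨
  B x + B (2 * q)            ∎
  where
  open ≡-Reasoning
  shift : x * 2 ^ suc s + 2 * q ≡ 2 * (x * 2 ^ s + q)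
  shift = lemma x (2 ^ s) q
    where lemma : ∀ x P q → x * (2 * P) + 2 * q ≡ 2 * (x * P + q)
          lemma = solve-∀
... | odd q = begin
  B (x * 2 ^ suc s + suc (2 * q))  ≡⟨ cong B shift ⟩
  B (suc (2 * (x * 2 ^ s + q)))    ≡⟨ B-double+1 (x * 2 ^ s + q) ⟩
  suc (B (x * 2 ^ s + q))          ≡⟨ cong suc (B-concat s x q (*-cancelˡ-< 2 q (2 ^ s) (<-trans (n<1+n _) y<))) ⟩
  suc (B x + B q)                  ≡⟨ +-suc (B x) (B q) ⟨
  B x + suc (B q)                  ≡⟨ cong (B x +_) (B-double+1 q) ⟨
  B x + B (suc (2 * q))            ∎
  where
  open ≡-Reasoning
  shift : x * 2 ^ suc s + suc (2 * q) ≡ suc (2 * (x * 2 ^ s + q))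
  shift = lemma x (2 ^ s) q
    where lemma : ∀ x P q → x * (2 * P) + (1 + 2 * q) ≡ 1 + 2 * (x * P + q)
          lemma = solve-∀

B-complement : ∀ k x y → suc (x + y) ≡ 2 ^ k → B x + B y ≡ k
B-complement zero    zero    zero    _ = refl
B-complement (suc k) x       y       e with halves x | halves y
... | even q | even r = ⊥-elim (even≢odd (2 ^ k) (q + r) (trans (sym e) (cong suc (lemma q r))))
  where lemma : ∀ q r → 2 * q + 2 * r ≡ 2 * (q + r)
        lemma = solve-∀
... | odd q  | odd r  = ⊥-elim (even≢odd (2 ^ k) (suc (q + r)) (trans (sym e) (lemma q r)))
  where lemma : ∀ q r → 1 + ((1 + 2 * q) + (1 + 2 * r)) ≡ 1 + 2 * (1 + (q + r))
        lemma = solve-∀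
... | even q | odd r  = begin
  B (2 * q) + B (suc (2 * r))  ≡⟨ cong₂ _+_ (B-double q) (B-double+1 r) ⟩
  B q + suc (B r)              ≡⟨ +-suc (B q) (B r) ⟩
  suc (B q + B r)              ≡⟨ cong suc (B-complement k q r (*-cancelˡ-≡ _ _ 2 (trans (lemma q r) e))) ⟩
  suc k                        ∎
  where
  open ≡-Reasoning
  lemma : ∀ q r → 2 * suc (q + r) ≡ suc (2 * q + suc (2 * r))
  lemma = solve-∀
... | odd q  | even r = begin
  B (suc (2 * q)) + B (2 * r)  ≡⟨ cong₂ _+_ (B-double+1 q) (B-double r) ⟩
  suc (B q + B r)              ≡⟨ cong suc (B-complement k q r (*-cancelˡ-≡ _ _ 2 (trans (lemma q r) e))) ⟩
  suc k                        ∎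
  where
  open ≡-Reasoning
  lemma : ∀ q r → 2 * suc (q + r) ≡ suc (suc (2 * q) + 2 * r)
  lemma = solve-∀

B-≤ : ∀ k y → y < 2 ^ k → B y ≤ k
B-≤ k y y< with m≤n⇒∃[o]m+o≡n y<
... | z , e = subst (B y ≤_) (B-complement k y z e) (m≤m+n (B y) (B z))

B-square-of-complement : ∀ ℓ t d → t + suc d ≡ 2 ^ ℓ → 2 * suc d ≤ 2 ^ ℓ → suc d * suc d < 2 ^ ℓ →
                         B (t * t) + suc (B d) ≡ ℓ + B (suc d * suc d)
B-square-of-complement ℓ t d t+e≡Q 2e≤Q e*e<Q = begin
  B (t * t) + suc (B d)          ≡⟨ cong (λ b → b + suc (B d)) B-t*t ⟩
  B g + B (e * e) + suc (B d)    ≡⟨ swap (B g) (B (e * e)) (suc (B d)) ⟩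
  B g + suc (B d) + B (e * e)    ≡⟨ cong (λ b → b + B (e * e)) B-g ⟩
  ℓ + B (e * e)                  ∎
  where
  open ≡-Reasoning
  e Q g : ℕ
  e = suc d
  Q = 2 ^ ℓ
  g = Q ∸ 2 * e
  g+2e≡Q : g + 2 * e ≡ Q
  g+2e≡Q = m∸n+n≡m 2e≤Q
  t≡g+e : t ≡ g + e
  t≡g+e = +-cancelʳ-≡ e t (g + e) (trans t+e≡Q (trans (sym g+2e≡Q) (identity g e)))
    where identity : ∀ g e → g + 2 * e ≡ g + e + e
          identity = solve-∀
  B-t*t : B (t * t) ≡ B g + B (e * e)
  B-t*t = begin
    B (t * t)                ≡⟨ cong (λ x → B (x * x)) t≡g+e ⟩
    B ((g + e) * (g + e))    ≡⟨ cong B (identity g e) ⟩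
    B (g * (g + 2 * e) + e * e) ≡⟨ cong (λ q → B (g * q + e * e)) g+2e≡Q ⟩
    B (g * Q + e * e)        ≡⟨ B-concat ℓ g (e * e) e*e<Q ⟩
    B g + B (e * e)          ∎
    where identity : ∀ g e → (g + e) * (g + e) ≡ g * (g + 2 * e) + e * e
          identity = solve-∀
  B-g : B g + suc (B d) ≡ ℓ
  B-g = trans (cong (B g +_) (sym (B-double+1 d))) (B-complement ℓ g (suc (2 * d)) (trans (identity g d) g+2e≡Q))
    where identity : ∀ g d → suc (g + suc (2 * d)) ≡ g + 2 * suc d
          identity = solve-∀
  swap : ∀ x y z → x + y + z ≡ x + z + y
  swap = solve-∀

module Witness {a L c : ℕ} (t<A : suc c < 2 ^ a) (2tA≤E : 2 * (suc c * 2 ^ a) ≤ 2 ^ L) where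

  -- m = (A − 1)E − t is stored as X·E + R with X = A − 2 and R = E − t, where v = A − 1 − t;
  -- Y = E − 2t(A − 1) is the middle block of m².
  t A E v X Y R m : ℕ
  t = suc c
  A = 2 ^ a
  E = 2 ^ L
  v = A ∸ suc t
  X = v + c
  Y = E ∸ 2 * (t * (v + t))
  R = t * suc (2 * X) + Y
  m = X * E + R

  A-split : v + suc t ≡ A
  A-split = m∸n+n≡m t<A

  2+X≡A : 2 + X ≡ A
  2+X≡A = trans (sym (trans (+-suc v (suc c)) (cong suc (+-suc v c)))) A-split

  v<A : v < A
  v<A = subst (v <_) A-split (m<m+n v z<s)

  v+t<A : v + t < A
  v+t<A = subst (v + t <_) A-split (+-monoʳ-< v (n<1+n t))

  2t[v+t]≤E : 2 * (t * (v + t)) ≤ E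
  2t[v+t]≤E = ≤-trans (*-monoʳ-≤ 2 (*-monoʳ-≤ t (<⇒≤ v+t<A))) 2tA≤E

  E-split : Y + 2 * (t * (v + t)) ≡ E
  E-split = m∸n+n≡m 2t[v+t]≤E

  R+t≡E : R + t ≡ E
  R+t≡E = trans (identity c v Y) E-split
    where identity : ∀ c v Y → suc c * suc (2 * (v + c)) + Y + suc c ≡ Y + 2 * (suc c * (v + suc c))
          identity = solve-∀

  m-square : m * m ≡ ((X * A) * E + Y) * E + t * t
  m-square = begin
    m * m                                             ≡⟨ cong (λ e → (X * e + R) * (X * e + R)) (sym E-split) ⟩
    (X * E′ + R) * (X * E′ + R)                       ≡⟨ identity c v Y ⟩
    ((X * (v + suc t)) * E′ + Y) * E′ + t * t         ≡⟨ cong₂ (λ a e → ((X * a) * e + Y) * e + t * t) A-split E-split ⟩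
    ((X * A) * E + Y) * E + t * t                     ∎
    where
    open ≡-Reasoning
    E′ : ℕ
    E′ = Y + 2 * (t * (v + t))
    identity : ∀ c v Y → let t = suc c; X = v + c; E′ = Y + 2 * (t * (v + t)); R = t * suc (2 * X) + Y in
      (X * E′ + R) * (X * E′ + R) ≡ ((X * (v + suc t)) * E′ + Y) * E′ + t * t
    identity = solve-∀

  R<E : R < E
  R<E = subst (R <_) R+t≡E (m<m+n R z<s)

  t*t<E : t * t < E
  t*t<E = begin-strict
    t * t            <⟨ *-monoʳ-< t t<A ⟩
    t * A            ≤⟨ m≤m+n (t * A) (t * A + 0) ⟩
    2 * (t * A)      ≤⟨ 2tA≤E ⟩
    E                ∎
    where open ≤-Reasoning

  1≤m : 1 ≤ m
  1≤m = ≤-trans (s≤s z≤n) (m≤n+m R (X * E))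

  m<A*E : m < A * E
  m<A*E = begin-strict
    X * E + R        <⟨ +-monoʳ-< (X * E) R<E ⟩
    X * E + E        ≡⟨ +-comm (X * E) E ⟩
    suc X * E        ≤⟨ *-monoˡ-≤ E (subst (suc X ≤_) 2+X≡A (n≤1+n (suc X))) ⟩
    A * E            ∎
    where open ≤-Reasoning

  W : ℕ
  W = c * A + v

  Y-split : suc (Y + suc (2 * W)) ≡ E
  Y-split = begin
    suc (Y + suc (2 * (c * A + v)))              ≡⟨ cong (λ a → suc (Y + suc (2 * (c * a + v)))) (sym A-split) ⟩
    suc (Y + suc (2 * (c * (v + suc t) + v)))    ≡⟨ identity c v Y ⟨
    Y + 2 * (t * (v + t))                        ≡⟨ E-split ⟩
    E                                            ∎
    where
    open ≡-Reasoning
    identity : ∀ c v Y → Y + 2 * (suc c * (v + suc c)) ≡ suc (Y + suc (2 * (c * (v + suc (suc c)) + v)))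
    identity = solve-∀

  Y<E : Y < E
  Y<E = subst (Y <_) Y-split (s≤s (m≤m+n Y _))

  B-X*A : B (X * A) ≡ B X
  B-X*A = begin
    B (X * A)      ≡⟨ cong B (+-identityʳ (X * A)) ⟨
    B (X * A + 0)  ≡⟨ B-concat a X 0 (m^n>0 2 a) ⟩
    B X + 0        ≡⟨ +-identityʳ (B X) ⟩
    B X            ∎
    where open ≡-Reasoning

  B-m : B m ≡ B X + B R
  B-m = B-concat L X R R<E

  B-m*m : B (m * m) ≡ B X + B Y + B (t * t)
  B-m*m = begin
    B (m * m)                                ≡⟨ cong B m-square ⟩
    B (((X * A) * E + Y) * E + t * t)        ≡⟨ B-concat L ((X * A) * E + Y) (t * t) t*t<E ⟩
    B ((X * A) * E + Y) + B (t * t)          ≡⟨ cong (_+ B (t * t)) (B-concat L (X * A) Y Y<E) ⟩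
    B (X * A) + B Y + B (t * t)              ≡⟨ cong (λ b → b + B Y + B (t * t)) B-X*A ⟩
    B X + B Y + B (t * t)                    ∎
    where open ≡-Reasoning

  B-R : B R + B c ≡ L
  B-R = B-complement L R c (trans (sym (+-suc R c)) R+t≡E)

  B-Y : B Y + suc (B c + B v) ≡ L
  B-Y = begin
    B Y + suc (B c + B v)   ≡⟨ cong (λ b → B Y + suc b) (B-concat a c v v<A) ⟨
    B Y + suc (B W)         ≡⟨ cong (B Y +_) (B-double+1 W) ⟨
    B Y + B (suc (2 * W))   ≡⟨ B-complement L Y (suc (2 * W)) Y-split ⟩
    L                       ∎
    where open ≡-Reasoning

  B-v : B v + B t ≡ a
  B-v = B-complement a v t (trans (sym (+-suc v t)) A-split)

  square-preserves-B : B t + B (t * t) ≡ suc a → B (m * m) ≡ B m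
  square-preserves-B digits = begin
    B (m * m)                 ≡⟨ B-m*m ⟩
    B X + B Y + B (t * t)     ≡⟨ +-assoc (B X) (B Y) (B (t * t)) ⟩
    B X + (B Y + B (t * t))   ≡⟨ cong (B X +_) B-Y+B-t*t ⟩
    B X + B R                 ≡⟨ B-m ⟨
    B m                       ∎
    where
    open ≡-Reasoning
    B-t*t : B (t * t) ≡ suc (B v)
    B-t*t = +-cancelˡ-≡ (B t) _ _ (begin
      B t + B (t * t)   ≡⟨ digits ⟩
      suc a             ≡⟨ cong suc B-v ⟨
      suc (B v + B t)   ≡⟨ cong suc (+-comm (B v) (B t)) ⟩
      suc (B t + B v)   ≡⟨ +-suc (B t) (B v) ⟨
      B t + suc (B v)   ∎)
    B-Y+B-t*t : B Y + B (t * t) ≡ B R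
    B-Y+B-t*t = +-cancelʳ-≡ (B c) _ _ (begin
      B Y + B (t * t) + B c     ≡⟨ cong (λ b → B Y + b + B c) B-t*t ⟩
      B Y + suc (B v) + B c     ≡⟨ rearrange (B Y) (B v) (B c) ⟩
      B Y + suc (B c + B v)     ≡⟨ B-Y ⟩
      L                         ≡⟨ B-R ⟨
      B R + B c                 ∎)
      where rearrange : ∀ y v c → y + suc v + c ≡ y + suc (c + v)
            rearrange = solve-∀

module Witnesses (h d : ℕ) (d<2^h : d < 2 ^ h) where

  ℓ Q c t s a L : ℕ
  ℓ = 2 + (h + h)
  Q = 2 ^ ℓ
  c = Q ∸ (2 + d)
  t = suc c
  s = B t + B (t * t)
  a = pred s
  L = suc (ℓ + (ℓ + (ℓ + ℓ)))

  2^[h+h]<Q : 2 ^ (h + h) < Q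
  2^[h+h]<Q = ^-monoʳ-< 2 (s≤s (s≤s z≤n)) (<-trans (n<1+n (h + h)) (n<1+n _))

  2e≤Q : 2 * suc d ≤ Q
  2e≤Q = ≤-trans (*-monoʳ-≤ 2 d<2^h) (^-monoʳ-≤ 2 (s≤s (≤-trans (m≤m+n h h) (n≤1+n _))))

  e*e<Q : suc d * suc d < Q
  e*e<Q = begin-strict
    suc d * suc d     ≤⟨ *-mono-≤ d<2^h d<2^h ⟩
    2 ^ h * 2 ^ h     ≡⟨ ^-distribˡ-+-* 2 h h ⟨
    2 ^ (h + h)       <⟨ 2^[h+h]<Q ⟩
    Q                 ∎
    where open ≤-Reasoning

  t+e≡Q : t + suc d ≡ Q
  t+e≡Q = trans (sym (+-suc c (suc d))) (m∸n+n≡m (≤-trans 2+d≤2e 2e≤Q))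
    where 2+d≤2e : 2 + d ≤ 2 * suc d
          2+d≤2e = subst (2 + d ≤_) (identity d) (m≤m+n (2 + d) d)
            where identity : ∀ d → 2 + d + d ≡ 2 * suc d
                  identity = solve-∀

  t<Q : t < Q
  t<Q = subst (t <_) t+e≡Q (m<m+n t z<s)

  B-t : B t + B d ≡ ℓ
  B-t = B-complement ℓ t d (trans (sym (+-suc t d)) t+e≡Q)

  ℓ<s : ℓ < s
  ℓ<s = +-cancelʳ-≤ (suc (2 * B d)) (suc ℓ) s (begin
    suc ℓ + suc (2 * B d)                    ≤⟨ +-monoʳ-≤ (suc ℓ) (s≤s (*-monoʳ-≤ 2 (B-≤ h d d<2^h))) ⟩
    suc ℓ + suc (2 * h)                      ≡⟨ identity₁ h ⟩
    ℓ + ℓ                                    ≤⟨ m≤m+n (ℓ + ℓ) (B (suc d * suc d)) ⟩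
    ℓ + ℓ + B (suc d * suc d)                ≡⟨ +-assoc ℓ ℓ _ ⟩
    ℓ + (ℓ + B (suc d * suc d))              ≡⟨ cong₂ _+_ (sym B-t) (sym B-t*t) ⟩
    (B t + B d) + (B (t * t) + suc (B d))    ≡⟨ identity₂ (B t) (B d) (B (t * t)) ⟩
    s + suc (2 * B d)                        ∎)
    where
    open ≤-Reasoning
    B-t*t : B (t * t) + suc (B d) ≡ ℓ + B (suc d * suc d)
    B-t*t = B-square-of-complement ℓ t d t+e≡Q 2e≤Q e*e<Q
    identity₁ : ∀ h → let ℓ = 2 + (h + h) in suc ℓ + suc (2 * h) ≡ ℓ + ℓ
    identity₁ = solve-∀
    identity₂ : ∀ x y z → (x + y) + (z + suc y) ≡ x + z + suc (2 * y)
    identity₂ = solve-∀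

  s≤3ℓ : s ≤ ℓ + (ℓ + ℓ)
  s≤3ℓ = +-mono-≤ (B-≤ ℓ t t<Q) (B-≤ (ℓ + ℓ) (t * t) t*t<2^[ℓ+ℓ])
    where t*t<2^[ℓ+ℓ] : t * t < 2 ^ (ℓ + ℓ)
          t*t<2^[ℓ+ℓ] = subst (t * t <_) (sym (^-distribˡ-+-* 2 ℓ ℓ)) (*-mono-< t<Q t<Q)

  s≡1+a : s ≡ suc a
  s≡1+a = sym (suc-pred s {{>-nonZero (≤-trans z<s ℓ<s)}})

  t<A : t < 2 ^ a
  t<A = <-≤-trans t<Q (^-monoʳ-≤ 2 (≤-pred (subst (ℓ <_) s≡1+a ℓ<s)))

  a≤3ℓ : a ≤ ℓ + (ℓ + ℓ)
  a≤3ℓ = ≤-trans pred[n]≤n s≤3ℓ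

  2tA≤E : 2 * (t * 2 ^ a) ≤ 2 ^ L
  2tA≤E = begin
    2 * (t * 2 ^ a)         ≤⟨ *-monoʳ-≤ 2 (*-monoˡ-≤ (2 ^ a) (<⇒≤ t<Q)) ⟩
    2 * (Q * 2 ^ a)         ≡⟨ cong (2 *_) (^-distribˡ-+-* 2 ℓ a) ⟨
    2 ^ suc (ℓ + a)         ≤⟨ ^-monoʳ-≤ 2 (s≤s (+-monoʳ-≤ ℓ a≤3ℓ)) ⟩
    2 ^ L                   ∎
    where open ≤-Reasoning

  open Witness {a} {L} {c} t<A 2tA≤E public using (m; X; R; R+t≡E; R<E; 1≤m; m<A*E; square-preserves-B)

  m<2^[14h+15] : m < 2 ^ (h * 14 + 15)
  m<2^[14h+15] = begin-strict
    m                 <⟨ m<A*E ⟩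
    2 ^ a * 2 ^ L     ≡⟨ ^-distribˡ-+-* 2 a L ⟨
    2 ^ (a + L)       ≤⟨ ^-monoʳ-≤ 2 (≤-trans (+-monoˡ-≤ L a≤3ℓ) (≤-reflexive (identity h))) ⟩
    2 ^ (h * 14 + 15) ∎
    where
    open ≤-Reasoning
    identity : ∀ h → let ℓ = 2 + (h + h) in ℓ + (ℓ + ℓ) + suc (ℓ + (ℓ + (ℓ + ℓ))) ≡ h * 14 + 15
    identity = solve-∀

  m-is-212 : B (m * m) ≡ B m
  m-is-212 = square-preserves-B s≡1+a

[m*n+r]%n≡r : ∀ x r {n} .{{_ : NonZero n}} → r < n → (x * n + r) % n ≡ r
[m*n+r]%n≡r x r {n} r<n = trans (cong (_% n) (+-comm (x * n) r)) (trans ([m+kn]%n≡m%n r x n) (m<n⇒m%n≡m r<n))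

witness-injective : ∀ h d d′ (d< : d < 2 ^ h) (d′< : d′ < 2 ^ h) →
                    Witnesses.m h d d< ≡ Witnesses.m h d′ d′< → d ≡ d′
witness-injective h d d′ d< d′< m≡m′ =
  suc-injective (+-cancelˡ-≡ F.t _ _ (trans F.t+e≡Q (trans (sym F′.t+e≡Q) (cong (_+ suc d′) (sym t≡t′)))))
  where
  module F = Witnesses h d d<
  module F′ = Witnesses h d′ d′<
  R≡R′ : F.R ≡ F′.R
  R≡R′ = begin
    F.R             ≡⟨ [m*n+r]%n≡r F.X F.R F.R<E ⟨
    F.m % 2 ^ F.L   ≡⟨ cong (_% 2 ^ F.L) m≡m′ ⟩
    F′.m % 2 ^ F.L  ≡⟨ [m*n+r]%n≡r F′.X F′.R F′.R<E ⟩
    F′.R            ∎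
    where
    open ≡-Reasoning
    instance
      E≢0 : NonZero (2 ^ F.L)
      E≢0 = m^n≢0 2 F.L
  t≡t′ : F.t ≡ F′.t
  t≡t′ = +-cancelˡ-≡ F.R _ _ (trans F.R+t≡E (trans (sym F′.R+t≡E) (cong (_+ F′.t) (sym R≡R′))))

is212-holds : ∀ m → 1 ≤ m → B (m * m) ≡ B m → is212 m ≡ 1
is212-holds (suc k) _ e with B (suc k * suc k) ≡ᵇ B (suc k) | ≡⇒≡ᵇ (B (suc k * suc k)) (B (suc k)) e
... | true | _ = refl

p212-step : ∀ x → is212 x ≡ 1 → p212 x ≡ suc (p212 (pred x))
p212-step (suc x) e = cong (_+ p212 x) e

p212-mono : ∀ {x y} → x ≤ y → p212 x ≤ p212 y
p212-mono x≤y = go (≤⇒≤′ x≤y)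
  where
  go : ∀ {x y} → x ≤′ y → p212 x ≤ p212 y
  go ≤′-refl             = ≤-refl
  go (≤′-step {y} x≤′y) = ≤-trans (go x≤′y) (m≤n+m (p212 y) (is212 (suc y)))

p212-mono-< : ∀ {x y} → x < y → is212 y ≡ 1 → p212 x < p212 y
p212-mono-< {x} {suc y} (s≤s x≤y) e = subst (p212 x <_) (sym (p212-step (suc y) e)) (s≤s (p212-mono x≤y))

p212-injective : ∀ {x y} → is212 x ≡ 1 → is212 y ≡ 1 → p212 x ≡ p212 y → x ≡ y
p212-injective {x} {y} ex ey px≡py with <-cmp x y
... | tri< x<y _ _ = contradiction px≡py (<⇒≢ (p212-mono-< x<y ey))
... | tri≈ _ x≡y _ = x≡y
... | tri> _ _ y<x = contradiction (sym px≡py) (<⇒≢ (p212-mono-< y<x ex))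

M≤p212 : ∀ {M n} (g : Fin M → ℕ) → Injective _≡_ _≡_ g →
         (∀ i → is212 (g i) ≡ 1) → (∀ i → g i ≤ n) → M ≤ p212 n
M≤p212 {M} {n} g g-injective g-212 g≤n = injective⇒≤ rank-injective
  where
  rank< : ∀ i → p212 (pred (g i)) < p212 n
  rank< i = subst (_≤ p212 n) (p212-step (g i) (g-212 i)) (p212-mono (g≤n i))
  rank : Fin M → Fin (p212 n)
  rank i = fromℕ< (rank< i)
  rank-injective : Injective _≡_ _≡_ rank
  rank-injective {i} {j} ri≡rj = g-injective (p212-injective (g-212 i) (g-212 j) (begin
    p212 (g i)                ≡⟨ p212-step (g i) (g-212 i) ⟩
    suc (p212 (pred (g i)))   ≡⟨ cong suc (trans (sym (toℕ-fromℕ< (rank< i))) (trans (cong toℕ ri≡rj) (toℕ-fromℕ< (rank< j)))) ⟩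
    suc (p212 (pred (g j)))   ≡⟨ p212-step (g j) (g-212 j) ⟨
    p212 (g j)                ∎))
    where open ≡-Reasoning

2^h≤p212 : ∀ h → 2 ^ h ≤ p212 (2 ^ (h * 14 + 15))
2^h≤p212 h = M≤p212 g g-injective g-212 (λ i → <⇒≤ (Witnesses.m<2^[14h+15] h (toℕ i) (toℕ<n i)))
  where
  g : Fin (2 ^ h) → ℕ
  g i = Witnesses.m h (toℕ i) (toℕ<n i)
  g-injective : Injective _≡_ _≡_ g
  g-injective {i} {j} gi≡gj = toℕ-injective (witness-injective h (toℕ i) (toℕ j) (toℕ<n i) (toℕ<n j) gi≡gj)
  g-212 : ∀ i → is212 (g i) ≡ 1
  g-212 i = is212-holds (g i) (Witnesses.1≤m h (toℕ i) (toℕ<n i)) (Witnesses.m-is-212 h (toℕ i) (toℕ<n i))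

dyadic-bracket : ∀ k b {n} → 2 ^ b ≤ n → ∃[ h ] 2 ^ (h * suc k + b) ≤ n × n < 2 ^ (suc h * suc k + b)
dyadic-bracket k b 2^b≤n = go (≤⇒≤′ 2^b≤n)
  where
  K : ℕ
  K = suc k
  go : ∀ {n} → 2 ^ b ≤′ n → ∃[ h ] 2 ^ (h * K + b) ≤ n × n < 2 ^ (suc h * K + b)
  go ≤′-refl = 0 , ≤-refl , ^-monoʳ-< 2 (s≤s (s≤s z≤n)) (m<n+m b {K + 0} z<s)
  go (≤′-step {n} p) with go p
  ... | h , lower , upper with m≤n⇒m<n∨m≡n upper
  ...   | inj₁ n<2^⋯ = h , ≤-trans lower (n≤1+n n) , n<2^⋯
  ...   | inj₂ n≡2^⋯ = suc h , ≤-reflexive (sym n≡2^⋯) ,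
                          subst (_< 2 ^ (suc (suc h) * K + b)) (sym n≡2^⋯)
                                (^-monoʳ-< 2 (s≤s (s≤s z≤n)) (+-monoˡ-< b (m<n+m (suc h * K) {K} z<s)))

dyadic-growth : (p : ℕ → ℕ) → (∀ {x y} → x ≤ y → p x ≤ p y) → ∀ k b e → suc k ≤ e →
                (∀ h → 2 ^ h ≤ p (2 ^ (h * suc k + b))) →
                ∀ n → 2 ^ b ≤ n → n ≤ (2 ^ (suc k + b) * p n) ^ e
dyadic-growth p p-mono k b e K≤e 2^h≤p n 2^b≤n with dyadic-bracket k b 2^b≤n
... | h , lower , upper = begin
  n                              ≤⟨ <⇒≤ upper ⟩
  2 ^ (suc h * K + b)            ≤⟨ ^-monoʳ-≤ 2 exponent-≤ ⟩
  2 ^ ((K + b + h) * e)          ≡⟨ ^-*-assoc 2 (K + b + h) e ⟨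
  (2 ^ (K + b + h)) ^ e          ≡⟨ cong (_^ e) (^-distribˡ-+-* 2 (K + b) h) ⟩
  (2 ^ (K + b) * 2 ^ h) ^ e      ≤⟨ ^-monoˡ-≤ e (*-monoʳ-≤ (2 ^ (K + b)) (≤-trans (2^h≤p h) (p-mono lower))) ⟩
  (2 ^ (K + b) * p n) ^ e        ∎
  where
  open ≤-Reasoning
  K : ℕ
  K = suc k
  exponent-≤ : suc h * K + b ≤ (K + b + h) * e
  exponent-≤ = begin
    suc h * K + b          ≡⟨ identity₁ k b h ⟩
    (K + b) + h * K        ≤⟨ +-monoˡ-≤ (h * K) (m≤m*n (K + b) K) ⟩
    (K + b) * K + h * K    ≡⟨ identity₂ k b h ⟩
    (K + b + h) * K        ≤⟨ *-monoʳ-≤ (K + b + h) K≤e ⟩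
    (K + b + h) * e        ∎
    where
    identity₁ : ∀ k b h → suc h * suc k + b ≡ (suc k + b) + h * suc k
    identity₁ = solve-∀
    identity₂ : ∀ k b h → (suc k + b) * suc k + h * suc k ≡ (suc k + b + h) * suc k
    identity₂ = solve-∀

theorem3 : Σ ℕ λ k → Σ ℕ λ N → (n : ℕ) → N ≤ n → n ≤ (suc k * p212 n) ^ 40
theorem3 = 2 ^ 29 ∸ 1 , 2 ^ 15 , dyadic-growth p212 p212-mono 13 15 40 (m≤m+n 14 26) 2^h≤p212
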